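{- Let $G$ be a graph with a unique universal vertex $u$ (a vertex adjacent to all other vertices), and suppose $G\in\mathfrak{T}$. Then $W_\tau(G)\leq |V(G)|+2k(G)$, where $k(G)=\max_{v\in V(G),\,v\neq u} d_G(v)$.
   Context: All graphs are finite, undirected, without loops or multiple edges. A total coloring of a graph $G$ is an assignment of colors to the vertices and edges of $G$ such that no two adjacent vertices, no two adjacent edges, and no vertex and an edge incident to it receive the same color. For a positive integer $t$, an interval total $t$-coloring of $G$ is a total coloring of $G$ with colors $1,2,\ldots,t$ such that each color $i\in\{1,\ldots,t\}$ is used on at least one vertex or edge, and for each vertex $v$ the set consisting of the color of $v$ and the colors of the edges incident to $v$ consists of $d_G(v)+1$ consecutive integers, where $d_G(v)$ is the degree of $v$. $\mathfrak{T}$ is the set of graphs having an interval total $t$-coloring for some $t\geq1$, and for $G\in\mathfrak{T}$, $W_\tau(G)$ is the greatest such $t$. -}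

module Defs where

open import Data.Nat using (ℕ; _≤_; _+_; _⊔_)
open import Data.Fin using (Fin; _≟_)
open import Data.Bool using (Bool; true; false; not)
open import Data.List using (List; length; filterᵇ; allFin; map; foldr)
open import Data.Product using (Σ; ∃; _×_; _,_)
open import Data.Sum using (_⊎_)
open import Relation.Binary.PropositionalEquality using (_≡_; _≢_)
open import Relation.Nullary.Decidable using (⌊_⌋)

record Graph (n : ℕ) : Set where
  field
    adj   : Fin n → Fin n → Bool
    sym   : ∀ u v → adj u v ≡ adj v u
    irrefl : ∀ v → adj v v ≡ false
open Graph public

degree : ∀ {n} → Graph n → Fin n → ℕ
degree {n} G v = length (filterᵇ (adj G v) (allFin n))

Adj : ∀ {n} → Graph n → Fin n → Fin n → Set
Adj G v w = adj G v w ≡ true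

Universal : ∀ {n} → Graph n → Fin n → Set
Universal {n} G u = ∀ (v : Fin n) → v ≢ u → Adj G u v

UniqueUniversal : ∀ {n} → Graph n → Fin n → Set
UniqueUniversal {n} G u = Universal G u × (∀ (w : Fin n) → Universal G w → w ≡ u)

-- k(G) = max_{v ≠ u} d_G(v)  (0 if there is no such v)
kG : ∀ {n} → Graph n → Fin n → ℕ
kG {n} G u = foldr _⊔_ 0 (map (degree G) (filterᵇ (λ v → not ⌊ v ≟ u ⌋) (allFin n)))

-- Interval total t-coloring: vertex colouring c, edge colouring e (e v w is the
-- colour of edge vw; only its values on edges matter; required symmetric).
record IntervalTotalColoring {n : ℕ} (G : Graph n) (t : ℕ) : Set where
  field
    c : Fin n → ℕ
    e : Fin n → Fin n → ℕ
    e-sym : ∀ v w → Adj G v w → e v w ≡ e w v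
    c-range : ∀ v → 1 ≤ c v × c v ≤ t
    e-range : ∀ v w → Adj G v w → 1 ≤ e v w × e v w ≤ t
    vv-proper : ∀ v w → Adj G v w → c v ≢ c w
    ee-proper : ∀ v w x → Adj G v w → Adj G v x → w ≢ x → e v w ≢ e v x
    ve-proper : ∀ v w → Adj G v w → c v ≢ e v w
    surj : ∀ i → 1 ≤ i → i ≤ t →
           (∃ λ v → c v ≡ i) ⊎ (∃ λ v → ∃ λ w → Adj G v w × e v w ≡ i)
    interval : ∀ v → ∃ λ a → ∀ j →
      ((a ≤ j × j ≤ a + degree G v) → (c v ≡ j ⊎ (∃ λ w → Adj G v w × e v w ≡ j)))
      × ((c v ≡ j ⊎ (∃ λ w → Adj G v w × e v w ≡ j)) → (a ≤ j × j ≤ a + degree G v))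

InT : ∀ {n} → Graph n → Set
InT G = ∃ λ t → IntervalTotalColoring G t

-- The spectrum of colours at a vertex v is an interval of length d(v) + 1.  If u is universal,
-- every other vertex v shares the colour of the edge uv with u, so the spectrum of v lies
-- within k(G) of the spectrum of u.  Hence all t colours lie in an interval of length
-- d(u) + 1 + 2k(G) ≤ |V(G)| + 2k(G).
module Submission where

open import Defs
open import Data.Nat using (ℕ; zero; suc; _≤_; _<_; _+_; _*_; _⊔_; z≤n; s≤s)
open import Data.Nat.Properties
  using (≤-refl; ≤-trans; m≤m+n; m≤m⊔n; m≤n⊔m; +-monoˡ-≤; +-monoʳ-≤; module ≤-Reasoning)
open import Data.Nat.Tactic.RingSolver using (solve-∀)
open import Data.Bool using (T)
open import Data.Fin using (Fin; _≟_)
open import Data.List using (_∷_; allFin; foldr)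
open import Data.List.Properties using (filter-notAll; length-tabulate)
open import Data.List.Membership.Propositional using (_∈_; lose)
open import Data.List.Membership.Propositional.Properties using (∈-allFin; ∈-map⁺; ∈-filter⁺)
open import Data.List.Relation.Unary.Any using (here; there)
open import Data.Product using (∃; _×_; _,_; proj₁; proj₂)
open import Data.Sum using (_⊎_; inj₁; inj₂)
open import Function using (_∘_; id)
open import Relation.Binary.PropositionalEquality as ≡ using (_≡_; _≢_; refl; trans; subst)
open import Relation.Nullary using (yes; no)
open import Relation.Nullary.Decidable using (T?; fromWitnessFalse)

∈⇒≤foldr-⊔ : ∀ {x xs} → x ∈ xs → x ≤ foldr _⊔_ 0 xs
∈⇒≤foldr-⊔ {xs = y ∷ ys} (here refl) = m≤m⊔n y (foldr _⊔_ 0 ys)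
∈⇒≤foldr-⊔ {xs = y ∷ ys} (there x∈ys) = ≤-trans (∈⇒≤foldr-⊔ x∈ys) (m≤n⊔m y (foldr _⊔_ 0 ys))

degree<n : ∀ {n} (G : Graph n) (v : Fin n) → degree G v < n
degree<n {n} G v =
  subst (degree G v <_) (length-tabulate id)
    (filter-notAll (T? ∘ adj G v) (allFin n) (lose (∈-allFin v) (subst T (irrefl G v))))

degree≤kG : ∀ {n} (G : Graph n) {u v : Fin n} → v ≢ u → degree G v ≤ kG G u
degree≤kG {n} G {u} {v} v≢u =
  ∈⇒≤foldr-⊔ (∈-map⁺ (degree G) (∈-filter⁺ _ (∈-allFin v) (fromWitnessFalse v≢u)))

module Spectrum {n t : ℕ} {G : Graph n} (C : IntervalTotalColoring G t) where
  open IntervalTotalColoring C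

  InSpectrum : Fin n → ℕ → Set
  InSpectrum v x = c v ≡ x ⊎ ∃ λ w → Adj G v w × e v w ≡ x

  lowest : Fin n → ℕ
  lowest v = proj₁ (interval v)

  spectrum-bounds : ∀ {v x} → InSpectrum v x → lowest v ≤ x × x ≤ lowest v + degree G v
  spectrum-bounds {v} {x} = proj₂ (proj₂ (interval v) x)

  colour-used : ∀ {i} → 1 ≤ i → i ≤ t → ∃ λ v → InSpectrum v i
  colour-used {i} 1≤i i≤t with surj i 1≤i i≤t
  ... | inj₁ (v , cv≡i)           = v , inj₁ cv≡i
  ... | inj₂ (v , w , vw , evw≡i) = v , inj₂ (w , vw , evw≡i)

  neighbour-spectrum-bounds : ∀ {u v x} → Adj G u v → InSpectrum v x →
    lowest u ≤ x + degree G v × x ≤ lowest u + degree G u + degree G v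
  neighbour-spectrum-bounds {u} {v} {x} uv x∈v = lower , upper
    where
    open ≤-Reasoning
    vu : Adj G v u
    vu = trans (Graph.sym G v u) uv
    uv∈u : InSpectrum u (e u v)
    uv∈u = inj₂ (v , uv , refl)
    vu∈v : InSpectrum v (e v u)
    vu∈v = inj₂ (u , vu , refl)
    lower : lowest u ≤ x + degree G v
    lower = begin
      lowest u              ≤⟨ proj₁ (spectrum-bounds uv∈u) ⟩
      e u v                 ≡⟨ e-sym u v uv ⟩
      e v u                 ≤⟨ proj₂ (spectrum-bounds vu∈v) ⟩
      lowest v + degree G v ≤⟨ +-monoˡ-≤ (degree G v) (proj₁ (spectrum-bounds x∈v)) ⟩
      x + degree G v        ∎
    upper : x ≤ lowest u + degree G u + degree G v
    upper = begin
      x                                   ≤⟨ proj₂ (spectrum-bounds x∈v) ⟩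
      lowest v + degree G v               ≤⟨ +-monoˡ-≤ (degree G v) (proj₁ (spectrum-bounds vu∈v)) ⟩
      e v u + degree G v                  ≡⟨ ≡.cong (_+ degree G v) (e-sym v u vu) ⟩
      e u v + degree G v                  ≤⟨ +-monoˡ-≤ (degree G v) (proj₂ (spectrum-bounds uv∈u)) ⟩
      lowest u + degree G u + degree G v  ∎

  universal-spectrum-bounds : ∀ {u} → Universal G u → ∀ {v x} → InSpectrum v x →
    lowest u ≤ x + kG G u × x ≤ lowest u + degree G u + kG G u
  universal-spectrum-bounds {u} univ {v} {x} x∈v with v ≟ u
  ... | yes refl =
      ≤-trans (proj₁ (spectrum-bounds x∈v)) (m≤m+n x (kG G u))
    , ≤-trans (proj₂ (spectrum-bounds x∈v)) (m≤m+n _ (kG G u))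
  ... | no v≢u with neighbour-spectrum-bounds (univ v v≢u) x∈v
  ...   | lower , upper =
      ≤-trans lower (+-monoʳ-≤ x (degree≤kG G v≢u))
    , ≤-trans upper (+-monoʳ-≤ (lowest u + degree G u) (degree≤kG G v≢u))

theorem5 : ∀ (n : ℕ) (G : Graph n) (u : Fin n) → UniqueUniversal G u → InT G →
    ∀ (t : ℕ) → IntervalTotalColoring G t → t ≤ n + 2 * kG G u
theorem5 n G u (univ , _) _ zero    C = z≤n
theorem5 n G u (univ , _) _ (suc t) C = begin
  suc t             ≤⟨ proj₂ (bounds (proj₂ (colour-used (s≤s z≤n) ≤-refl))) ⟩
  lowest u + d + k  ≤⟨ +-monoˡ-≤ k (+-monoˡ-≤ d lowest-u≤1+k) ⟩
  1 + k + d + k     ≡⟨ rearrange k d ⟩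
  suc d + 2 * k     ≤⟨ +-monoˡ-≤ (2 * k) (degree<n G u) ⟩
  n + 2 * k         ∎
  where
  open Spectrum C
  open ≤-Reasoning
  d k : ℕ
  d = degree G u
  k = kG G u
  bounds : ∀ {v x} → InSpectrum v x → lowest u ≤ x + k × x ≤ lowest u + d + k
  bounds = universal-spectrum-bounds univ
  lowest-u≤1+k : lowest u ≤ 1 + k
  lowest-u≤1+k = proj₁ (bounds (proj₂ (colour-used ≤-refl (s≤s z≤n))))
  rearrange : ∀ a b → 1 + a + b + a ≡ suc b + 2 * a
  rearrange = solve-∀
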